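{- For $c\geq0$ and $\mathbf{k},\mathbf{l}\in W_{2,3}'$, we have \[ f_{2+2c}(\iota(\mathbf{l}),\iota(\mathbf{k}))=(-1)^{c}\theta(\mathbf{k}\star\mathbf{l},\{2\}^{c}). \]
   Context: Let $\mathfrak{X}=\mathbb{Q}\langle x_{1},x_{2},\dots\rangle$. For $c\geq1$, $f_{c}:\mathfrak{X}\times\mathfrak{X}\to\mathfrak{X}$ is the bilinear map determined by $f_{c}(u,1)=f_{c}(1,u)=x_{c}u$ and $f_{c}(x_{a}u,x_{b}v)=x_{c}f_{a}(u,x_{b}v)+x_{c}f_{b}(x_{a}u,v)-f_{c+a+b}(u,v)$ for $u,v\in\mathfrak{X}$. Let $W_{2,3}$ be the set of finite sequences of $2$ and $3$, and $W_{2,3}'$ the subset of those not ending with $2$. The binary operation $\star:W_{2,3}\times W_{2,3}\to\mathbb{Q}W_{2,3}$ (formal linear sums) is defined recursively by $\mathbf{k}\star\emptyset=\emptyset\star\mathbf{k}=\mathbf{k}$, $(\mathbf{k},2)\star\mathbf{k}'=\mathbf{k}\star(\mathbf{k}',2)=(\mathbf{k}\star\mathbf{k}',2)$, and $(\mathbf{k},3)\star(\mathbf{k}',3)=(\mathbf{k}\star(\mathbf{k}',3),3)+((\mathbf{k},3)\star\mathbf{k}',3)+(\mathbf{k}\star\mathbf{k}',2,2,2)$ (appending entries linearly). Define $\iota:W_{2,3}'\to\mathfrak{X}$ and $\theta:W_{2,3}\to\mathfrak{X}$ (extended linearly) by $\iota(\{2\}^{k_{d}},3,\dots,\{2\}^{k_{1}},3)=(-1)^{k_{1}+\cdots+k_{d}}x_{2k_{1}+3}\cdots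 x_{2k_{d}+3}$ and $\theta(\{2\}^{k_{d}},3,\dots,\{2\}^{k_{1}},3,\{2\}^{k_{0}})=(-1)^{k_{0}+\cdots+k_{d}}x_{2k_{0}+2}x_{2k_{1}+3}\cdots x_{2k_{d}+3}$, where $\{2\}^{k}$ denotes $k$ repetitions of $2$. -}

module Defs where

open import Data.Nat as ℕ using (ℕ; zero; suc)
open import Data.List using (List; []; _∷_; _++_; map; concatMap; foldr; replicate)
open import Data.List.Properties using (≡-dec)
open import Data.Product using (_×_; _,_; proj₁; proj₂)
open import Data.Rational using (ℚ; 0ℚ; 1ℚ; _+_; _*_; -_)
open import Relation.Binary.PropositionalEquality using (_≡_)
open import Relation.Nullary using (yes; no; ¬_)

-- The free noncommutative algebra  𝔛 = ℚ⟨x₁, x₂, …⟩.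
-- A word (monomial) is a list of indices: the list (a₁ ∷ … ∷ aₙ ∷ [])
-- stands for x_{a₁} ⋯ x_{aₙ}; [] is the unit 1.
-- An element of 𝔛 is a finite formal ℚ-linear combination of words,
-- compared by coefficients (_≈_ below).

Word : Set
Word = List ℕ

𝔛 : Set
𝔛 = List (ℚ × Word)

coeff : 𝔛 → Word → ℚ
coeff [] w = 0ℚ
coeff ((q , u) ∷ p) w with ≡-dec ℕ._≟_ u w
... | yes _ = q + coeff p w
... | no  _ = coeff p w

infix 4 _≈_
_≈_ : 𝔛 → 𝔛 → Set
p ≈ q = ∀ (w : Word) → coeff p w ≡ coeff q w

scale : ℚ → 𝔛 → 𝔛
scale r = map (λ t → r * proj₁ t , proj₂ t)

neg : 𝔛 → 𝔛
neg = scale (- 1ℚ)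

xmul : ℕ → 𝔛 → 𝔛
xmul c = map (λ t → proj₁ t , c ∷ proj₂ t)

mono : Word → 𝔛
mono w = (1ℚ , w) ∷ []

sgn : ℕ → ℚ
sgn zero = 1ℚ
sgn (suc n) = - sgn n

fw : ℕ → Word → Word → 𝔛
fw c u [] = mono (c ∷ u)
fw c [] (b ∷ v) = mono (c ∷ b ∷ v)
fw c (a ∷ u) (b ∷ v) =
  xmul c (fw a u (b ∷ v)) ++ (xmul c (fw b (a ∷ u) v) ++ neg (fw (c ℕ.+ a ℕ.+ b) u v))

f : ℕ → 𝔛 → 𝔛 → 𝔛
f c p q = concatMap (λ s → concatMap (λ t →
            scale (proj₁ s * proj₁ t) (fw c (proj₂ s) (proj₂ t))) q) p

-- Finite sequences of 2 and 3.  We use snoc-lists, since all the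
-- definitions append / inspect entries at the right end:
-- ((([] ▷ a₁) ▷ a₂) ▷ … ▷ aₙ) is the sequence (a₁, a₂, …, aₙ).

data D : Set where
  two three : D

infixl 5 _▷_
data W₂₃ : Set where
  [] : W₂₃
  _▷_ : W₂₃ → D → W₂₃

-- membership in W'_{2,3}: does not end with 2
NotEnd2 : W₂₃ → Set
NotEnd2 [] = Data.Unit.⊤ where import Data.Unit
NotEnd2 (k ▷ two) = Data.Empty.⊥ where import Data.Empty
NotEnd2 (k ▷ three) = Data.Unit.⊤ where import Data.Unit

_▷2^_ : W₂₃ → ℕ → W₂₃
k ▷2^ zero = k
k ▷2^ suc c = (k ▷2^ c) ▷ two

ℚW : Set
ℚW = List (ℚ × W₂₃)

mapW : (W₂₃ → W₂₃) → ℚW → ℚW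
mapW g = map (λ t → proj₁ t , g (proj₂ t))

infixl 6 _⋆_
_⋆_ : W₂₃ → W₂₃ → ℚW
k ⋆ [] = (1ℚ , k) ∷ []
[] ⋆ (k' ▷ e) = (1ℚ , k' ▷ e) ∷ []
(k ▷ two) ⋆ (k' ▷ e) = mapW (_▷ two) (k ⋆ (k' ▷ e))
(k ▷ three) ⋆ (k' ▷ two) = mapW (_▷ two) ((k ▷ three) ⋆ k')
(k ▷ three) ⋆ (k' ▷ three) =
  mapW (_▷ three) (k ⋆ (k' ▷ three))
  ++ (mapW (_▷ three) ((k ▷ three) ⋆ k')
  ++ mapW (λ w → w ▷ two ▷ two ▷ two) (k ⋆ k'))

-- Decomposition  k = ({2}^{k_d},3,…,{2}^{k_1},3,{2}^{k_0})
-- ↦ (k₀ , k₁ ∷ … ∷ k_d ∷ []).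

decomp : W₂₃ → ℕ × List ℕ
decomp [] = 0 , []
decomp (w ▷ two) = suc (proj₁ (decomp w)) , proj₂ (decomp w)
decomp (w ▷ three) = 0 , (proj₁ (decomp w) ∷ proj₂ (decomp w))

sumℕ : List ℕ → ℕ
sumℕ = foldr ℕ._+_ 0

odd3 : ℕ → ℕ
odd3 k = 2 ℕ.* k ℕ.+ 3

-- ι(({2}^{k_d},3,…,{2}^{k_1},3)) = (-1)^{k₁+⋯+k_d} x_{2k₁+3}⋯x_{2k_d+3}
-- (only used on W'_{2,3}, where k₀ = 0)
ι : W₂₃ → 𝔛
ι w = (sgn (sumℕ (proj₂ (decomp w))) , map odd3 (proj₂ (decomp w))) ∷ []

-- θ(({2}^{k_d},3,…,{2}^{k_1},3,{2}^{k₀}))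
--   = (-1)^{k₀+⋯+k_d} x_{2k₀+2} x_{2k₁+3}⋯x_{2k_d+3}
θ : W₂₃ → 𝔛
θ w = (sgn (proj₁ (decomp w) ℕ.+ sumℕ (proj₂ (decomp w))) ,
       (2 ℕ.* proj₁ (decomp w) ℕ.+ 2) ∷ map odd3 (proj₂ (decomp w))) ∷ []

θL : ℚW → 𝔛
θL = concatMap (λ t → scale (proj₁ t) (θ (proj₂ t)))

-- Write θ[ m ] for θ with its leading letter x_{2k₀+2} replaced by x_{2k₀+m}.
-- Appending a 2 to the argument of θ[ m ] costs a sign and shifts m to m + 2, and
-- appending a 3 turns θ[ m ] into left multiplication by x_m after θ[ 3 ].  With
-- these rules the three terms of the recursion of f_m on x_{2a+3}u and x_{2b+3}v
-- match, sign by sign, the three terms of the recursion of ⋆ on sequences ending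
-- in {2}^b,3 and {2}^a,3.  Induction on the number of 3s therefore gives
-- f_m(ι l, ι k) = θ[ m ](k ⋆ l) for every m, and the theorem is the case
-- m = 2 + 2c, because θ(w, {2}^c) = (-1)^c θ[ 2 + 2c ](w).

module Submission where

open import Defs
open import Data.Nat using (ℕ; zero; suc; _+_; _*_; _≟_)
import Data.Nat.Properties as ℕ
open import Data.Nat.Tactic.RingSolver using (solve-∀)
open import Data.List using (List; []; _∷_; _++_; map; concatMap)
open import Data.List.Properties
  using (≡-dec; ∷-injectiveˡ; ∷-injectiveʳ; map-++; map-∘; map-id; map-cong; concatMap-++; ++-identityʳ)
open import Data.Product using (_,_; proj₁; proj₂)
open import Data.Rational as ℚ using (ℚ; 0ℚ; 1ℚ)
import Data.Rational.Properties as ℚ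
open import Data.Rational.Solver using (module +-*-Solver)
open import Level using (0ℓ)
open import Relation.Binary.Bundles using (Setoid)
open import Relation.Nullary using (Dec; yes; no; ¬_; contradiction)
open import Relation.Binary.PropositionalEquality
import Relation.Binary.Reasoning.Setoid as SetoidReasoning

sgn-+ : ∀ m n → sgn (m + n) ≡ sgn m ℚ.* sgn n
sgn-+ zero    n = sym (ℚ.*-identityˡ (sgn n))
sgn-+ (suc m) n = trans (cong ℚ.-_ (sgn-+ m n)) (ℚ.neg-distribˡ-* (sgn m) (sgn n))

sgn-*-self : ∀ n → sgn n ℚ.* sgn n ≡ 1ℚ
sgn-*-self zero    = refl
sgn-*-self (suc n) = trans (neg*neg (sgn n)) (sgn-*-self n)
  where
  open +-*-Solver
  neg*neg : ∀ x → ℚ.- x ℚ.* ℚ.- x ≡ x ℚ.* x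
  neg*neg = solve 1 (λ x → (:- x) :* (:- x) := x :* x) refl

coeff-∷-≡ : ∀ q u p w → u ≡ w → coeff ((q , u) ∷ p) w ≡ q ℚ.+ coeff p w
coeff-∷-≡ q u p w u≡w with ≡-dec _≟_ u w
... | yes _   = refl
... | no u≢w = contradiction u≡w u≢w

coeff-∷-≢ : ∀ q u p w → ¬ u ≡ w → coeff ((q , u) ∷ p) w ≡ coeff p w
coeff-∷-≢ q u p w u≢w with ≡-dec _≟_ u w
... | yes u≡w = contradiction u≡w u≢w
... | no _    = refl

coeff-++ : ∀ p q w → coeff (p ++ q) w ≡ coeff p w ℚ.+ coeff q w
coeff-++ []            q w = sym (ℚ.+-identityˡ _)
coeff-++ ((r , u) ∷ p) q w with ≡-dec _≟_ u w
... | yes _ = trans (cong (r ℚ.+_) (coeff-++ p q w)) (sym (ℚ.+-assoc r _ _))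
... | no _  = coeff-++ p q w

coeff-scale : ∀ r p w → coeff (scale r p) w ≡ r ℚ.* coeff p w
coeff-scale r []            w = sym (ℚ.*-zeroʳ r)
coeff-scale r ((s , u) ∷ p) w with ≡-dec _≟_ u w
... | yes _ = trans (cong (r ℚ.* s ℚ.+_) (coeff-scale r p w)) (sym (ℚ.*-distribˡ-+ r s _))
... | no _  = coeff-scale r p w

coeff-xmul-∷ : ∀ c p w → coeff (xmul c p) (c ∷ w) ≡ coeff p w
coeff-xmul-∷ c []            w = refl
coeff-xmul-∷ c ((q , u) ∷ p) w = by-cases (≡-dec _≟_ u w)
  where
  open ≡-Reasoning
  by-cases : Dec (u ≡ w) → coeff (xmul c ((q , u) ∷ p)) (c ∷ w) ≡ coeff ((q , u) ∷ p) w
  by-cases (yes u≡w) = begin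
    coeff ((q , c ∷ u) ∷ xmul c p) (c ∷ w) ≡⟨ coeff-∷-≡ q (c ∷ u) _ _ (cong (c ∷_) u≡w) ⟩
    q ℚ.+ coeff (xmul c p) (c ∷ w)         ≡⟨ cong (q ℚ.+_) (coeff-xmul-∷ c p w) ⟩
    q ℚ.+ coeff p w                        ≡⟨ coeff-∷-≡ q u p w u≡w ⟨
    coeff ((q , u) ∷ p) w                  ∎
  by-cases (no u≢w) = begin
    coeff ((q , c ∷ u) ∷ xmul c p) (c ∷ w) ≡⟨ coeff-∷-≢ q (c ∷ u) _ _ (λ e → u≢w (∷-injectiveʳ e)) ⟩
    coeff (xmul c p) (c ∷ w)               ≡⟨ coeff-xmul-∷ c p w ⟩
    coeff p w                              ≡⟨ coeff-∷-≢ q u p w u≢w ⟨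
    coeff ((q , u) ∷ p) w                  ∎

coeff-xmul-∉ : ∀ c p w → (∀ v → ¬ w ≡ c ∷ v) → coeff (xmul c p) w ≡ 0ℚ
coeff-xmul-∉ c []            w w∉ = refl
coeff-xmul-∉ c ((q , u) ∷ p) w w∉ =
  trans (coeff-∷-≢ q (c ∷ u) _ w (λ e → w∉ u (sym e))) (coeff-xmul-∉ c p w w∉)

-- _≈_ unfolds to a Π-type, from which Agda cannot infer the two sums being
-- compared; wrapping it in a record makes them inferable.
infix 4 _≋_
record _≋_ (p q : 𝔛) : Set where
  constructor coeffwise
  field same-coeff : p ≈ q
open _≋_

𝔛-setoid : Setoid 0ℓ 0ℓ
𝔛-setoid = record
  { Carrier       = 𝔛
  ; _≈_           = _≋_
  ; isEquivalence = record
    { refl  = coeffwise λ _ → refl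
    ; sym   = λ p≋q → coeffwise λ w → sym (same-coeff p≋q w)
    ; trans = λ p≋q q≋r → coeffwise λ w → trans (same-coeff p≋q w) (same-coeff q≋r w)
    }
  }

++-cong : ∀ {p p′ q q′} → p ≋ p′ → q ≋ q′ → p ++ q ≋ p′ ++ q′
++-cong {p} {p′} {q} {q′} p≋p′ q≋q′ = coeffwise λ w → begin
  coeff (p ++ q) w             ≡⟨ coeff-++ p q w ⟩
  coeff p w ℚ.+ coeff q w      ≡⟨ cong₂ ℚ._+_ (same-coeff p≋p′ w) (same-coeff q≋q′ w) ⟩
  coeff p′ w ℚ.+ coeff q′ w    ≡⟨ coeff-++ p′ q′ w ⟨
  coeff (p′ ++ q′) w           ∎
  where open ≡-Reasoning

++-swap : ∀ p q r → p ++ (q ++ r) ≋ q ++ (p ++ r)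
++-swap p q r = coeffwise λ w → begin
  coeff (p ++ (q ++ r)) w
    ≡⟨ trans (coeff-++ p _ w) (cong (coeff p w ℚ.+_) (coeff-++ q r w)) ⟩
  coeff p w ℚ.+ (coeff q w ℚ.+ coeff r w)
    ≡⟨ solve 3 (λ x y z → x :+ (y :+ z) := y :+ (x :+ z)) refl (coeff p w) (coeff q w) (coeff r w) ⟩
  coeff q w ℚ.+ (coeff p w ℚ.+ coeff r w)
    ≡⟨ trans (coeff-++ q _ w) (cong (coeff q w ℚ.+_) (coeff-++ p r w)) ⟨
  coeff (q ++ (p ++ r)) w ∎
  where open ≡-Reasoning; open +-*-Solver

scale-cong : ∀ r {p q} → p ≋ q → scale r p ≋ scale r q
scale-cong r {p} {q} p≋q = coeffwise λ w →
  trans (coeff-scale r p w) (trans (cong (r ℚ.*_) (same-coeff p≋q w)) (sym (coeff-scale r q w)))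

xmul-cong : ∀ c {p q} → p ≋ q → xmul c p ≋ xmul c q
xmul-cong c {p} {q} p≋q = coeffwise same-coeff-xmul
  where
  same-coeff-xmul : xmul c p ≈ xmul c q
  same-coeff-xmul [] = trans (coeff-xmul-∉ c p [] λ _ ()) (sym (coeff-xmul-∉ c q [] λ _ ()))
  same-coeff-xmul (d ∷ w) with c ≟ d
  ... | yes refl = trans (coeff-xmul-∷ c p w) (trans (same-coeff p≋q w) (sym (coeff-xmul-∷ c q w)))
  ... | no c≢d   = trans (coeff-xmul-∉ c p _ d∷w∉) (sym (coeff-xmul-∉ c q _ d∷w∉))
    where
    d∷w∉ : ∀ v → ¬ d ∷ w ≡ c ∷ v
    d∷w∉ v e = c≢d (sym (∷-injectiveˡ e))

scale-scale : ∀ r s p → scale r (scale s p) ≡ scale (r ℚ.* s) p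
scale-scale r s p =
  trans (sym (map-∘ p)) (map-cong (λ t → cong (_, proj₂ t) (sym (ℚ.*-assoc r s (proj₁ t)))) p)

scale-xmul : ∀ r c p → scale r (xmul c p) ≡ xmul c (scale r p)
scale-xmul r c p = trans (sym (map-∘ p)) (map-∘ p)

scale-++ : ∀ r p q → scale r (p ++ q) ≡ scale r p ++ scale r q
scale-++ r = map-++ (λ t → r ℚ.* proj₁ t , proj₂ t)

xmul-++ : ∀ c p q → xmul c (p ++ q) ≡ xmul c p ++ xmul c q
xmul-++ c = map-++ (λ t → proj₁ t , c ∷ proj₂ t)

scale-comm : ∀ r s p → scale r (scale s p) ≡ scale s (scale r p)
scale-comm r s p = begin
  scale r (scale s p) ≡⟨ scale-scale r s p ⟩
  scale (r ℚ.* s) p   ≡⟨ cong (λ q → scale q p) (ℚ.*-comm r s) ⟩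
  scale (s ℚ.* r) p   ≡⟨ scale-scale s r p ⟨
  scale s (scale r p) ∎
  where open ≡-Reasoning

scale-identity : ∀ p → scale 1ℚ p ≡ p
scale-identity p =
  trans (map-cong (λ t → cong (_, proj₂ t) (ℚ.*-identityˡ (proj₁ t))) p) (map-id p)

scale-sgn-involutive : ∀ n p → scale (sgn n) (scale (sgn n) p) ≡ p
scale-sgn-involutive n p = begin
  scale (sgn n) (scale (sgn n) p) ≡⟨ scale-scale (sgn n) (sgn n) p ⟩
  scale (sgn n ℚ.* sgn n) p       ≡⟨ cong (λ r → scale r p) (sgn-*-self n) ⟩
  scale 1ℚ p                      ≡⟨ scale-identity p ⟩
  p                               ∎
  where open ≡-Reasoning

blocks : W₂₃ → List ℕ
blocks w = proj₂ (decomp w)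

fromBlocks : List ℕ → W₂₃
fromBlocks []      = []
fromBlocks (k ∷ L) = (fromBlocks L ▷2^ k) ▷ three

decomp-▷2^ : ∀ w j → decomp (w ▷2^ j) ≡ (j + proj₁ (decomp w) , blocks w)
decomp-▷2^ w zero    = refl
decomp-▷2^ w (suc j) = cong (λ d → suc (proj₁ d) , proj₂ d) (decomp-▷2^ w j)

decomp-fromBlocks : ∀ L → decomp (fromBlocks L) ≡ (0 , L)
decomp-fromBlocks []      = refl
decomp-fromBlocks (k ∷ L) rewrite decomp-▷2^ (fromBlocks L) k | decomp-fromBlocks L =
  cong (λ k′ → 0 , k′ ∷ L) (ℕ.+-identityʳ k)

fromBlocks-decomp : ∀ w → fromBlocks (blocks w) ▷2^ proj₁ (decomp w) ≡ w
fromBlocks-decomp []          = refl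
fromBlocks-decomp (w ▷ two)   = cong (_▷ two) (fromBlocks-decomp w)
fromBlocks-decomp (w ▷ three) = cong (_▷ three) (fromBlocks-decomp w)

fromBlocks-blocks : ∀ w → NotEnd2 w → fromBlocks (blocks w) ≡ w
fromBlocks-blocks []          _ = refl
fromBlocks-blocks (w ▷ three) _ = fromBlocks-decomp (w ▷ three)

mapW-∘ : ∀ g h T → mapW g (mapW h T) ≡ mapW (λ w → g (h w)) T
mapW-∘ g h T = sym (map-∘ T)

⋆-[]ˡ : ∀ k → [] ⋆ k ≡ (1ℚ , k) ∷ []
⋆-[]ˡ []      = refl
⋆-[]ˡ (k ▷ e) = refl

⋆-▷2ˡ : ∀ k k′ → (k ▷ two) ⋆ k′ ≡ mapW (_▷ two) (k ⋆ k′)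
⋆-▷2ˡ k []       = refl
⋆-▷2ˡ k (k′ ▷ e) = refl

⋆-▷2ʳ : ∀ k k′ → k ⋆ (k′ ▷ two) ≡ mapW (_▷ two) (k ⋆ k′)
⋆-▷2ʳ []          k′ rewrite ⋆-[]ˡ k′ = refl
⋆-▷2ʳ (k ▷ two)   k′ = cong (mapW (_▷ two)) (trans (⋆-▷2ʳ k k′) (sym (⋆-▷2ˡ k k′)))
⋆-▷2ʳ (k ▷ three) k′ = refl

⋆-▷2^ˡ : ∀ k k′ j → (k ▷2^ j) ⋆ k′ ≡ mapW (_▷2^ j) (k ⋆ k′)
⋆-▷2^ˡ k k′ zero    = sym (map-id (k ⋆ k′))
⋆-▷2^ˡ k k′ (suc j) = begin
  (k ▷2^ j ▷ two) ⋆ k′                  ≡⟨ ⋆-▷2ˡ (k ▷2^ j) k′ ⟩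
  mapW (_▷ two) ((k ▷2^ j) ⋆ k′)        ≡⟨ cong (mapW (_▷ two)) (⋆-▷2^ˡ k k′ j) ⟩
  mapW (_▷ two) (mapW (_▷2^ j) (k ⋆ k′)) ≡⟨ mapW-∘ (_▷ two) (_▷2^ j) (k ⋆ k′) ⟩
  mapW (_▷2^ suc j) (k ⋆ k′)             ∎
  where open ≡-Reasoning

⋆-▷2^ʳ : ∀ k k′ j → k ⋆ (k′ ▷2^ j) ≡ mapW (_▷2^ j) (k ⋆ k′)
⋆-▷2^ʳ k k′ zero    = sym (map-id (k ⋆ k′))
⋆-▷2^ʳ k k′ (suc j) = begin
  k ⋆ (k′ ▷2^ j ▷ two)                  ≡⟨ ⋆-▷2ʳ k (k′ ▷2^ j) ⟩
  mapW (_▷ two) (k ⋆ (k′ ▷2^ j))        ≡⟨ cong (mapW (_▷ two)) (⋆-▷2^ʳ k k′ j) ⟩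
  mapW (_▷ two) (mapW (_▷2^ j) (k ⋆ k′)) ≡⟨ mapW-∘ (_▷ two) (_▷2^ j) (k ⋆ k′) ⟩
  mapW (_▷2^ suc j) (k ⋆ k′)             ∎
  where open ≡-Reasoning

oddWord : List ℕ → Word
oddWord = map odd3

sgnΣ : List ℕ → ℚ
sgnΣ L = sgn (sumℕ L)

sgnΣ-∷ : ∀ k L → sgnΣ (k ∷ L) ≡ sgn k ℚ.* sgnΣ L
sgnΣ-∷ k L = sgn-+ k (sumℕ L)

θ[_] : ℕ → W₂₃ → 𝔛
θ[ m ] w = (sgn (proj₁ (decomp w) + sumℕ (blocks w)) ,
            (2 * proj₁ (decomp w) + m) ∷ oddWord (blocks w)) ∷ []

θL[_] : ℕ → ℚW → 𝔛
θL[ m ] = concatMap (λ t → scale (proj₁ t) (θ[ m ] (proj₂ t)))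

θ-fromBlocks : ∀ m L → θ[ m ] (fromBlocks L) ≡ (sgnΣ L , m ∷ oddWord L) ∷ []
θ-fromBlocks m L rewrite decomp-fromBlocks L = refl

θ-▷2^ : ∀ m j w → θ[ m ] (w ▷2^ j) ≡ scale (sgn j) (θ[ m + 2 * j ] w)
θ-▷2^ m j w rewrite decomp-▷2^ w j =
  cong₂ (λ q i → (q , i ∷ oddWord (blocks w)) ∷ [])
    (trans (cong sgn (ℕ.+-assoc j k₀ (sumℕ (blocks w)))) (sgn-+ j (k₀ + sumℕ (blocks w))))
    (index j k₀ m)
  where
  k₀ = proj₁ (decomp w)
  index : ∀ j k m → 2 * (j + k) + m ≡ 2 * k + (m + 2 * j)
  index = solve-∀

θL-single : ∀ m w → θL[ m ] ((1ℚ , w) ∷ []) ≡ θ[ m ] w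
θL-single m w = trans (++-identityʳ (scale 1ℚ (θ[ m ] w))) (scale-identity (θ[ m ] w))

θL-▷2^ : ∀ m j T → θL[ m ] (mapW (_▷2^ j) T) ≡ scale (sgn j) (θL[ m + 2 * j ] T)
θL-▷2^ m j []            = refl
θL-▷2^ m j ((q , w) ∷ T) = begin
  scale q (θ[ m ] (w ▷2^ j)) ++ θL[ m ] (mapW (_▷2^ j) T)
    ≡⟨ cong₂ _++_ (cong (scale q) (θ-▷2^ m j w)) (θL-▷2^ m j T) ⟩
  scale q (scale (sgn j) (θ[ m + 2 * j ] w)) ++ scale (sgn j) (θL[ m + 2 * j ] T)
    ≡⟨ cong (_++ scale (sgn j) (θL[ m + 2 * j ] T)) (scale-comm q (sgn j) (θ[ m + 2 * j ] w)) ⟩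
  scale (sgn j) (scale q (θ[ m + 2 * j ] w)) ++ scale (sgn j) (θL[ m + 2 * j ] T)
    ≡⟨ scale-++ (sgn j) (scale q (θ[ m + 2 * j ] w)) (θL[ m + 2 * j ] T) ⟨
  scale (sgn j) (θL[ m + 2 * j ] ((q , w) ∷ T)) ∎
  where open ≡-Reasoning

θL-▷3 : ∀ m T → θL[ m ] (mapW (_▷ three) T) ≡ xmul m (θL[ 3 ] T)
θL-▷3 m []            = refl
θL-▷3 m ((q , w) ∷ T) =
  trans (cong₂ _++_ (scale-xmul q m (θ[ 3 ] w)) (θL-▷3 m T)) (sym (xmul-++ m (scale q (θ[ 3 ] w)) (θL[ 3 ] T)))

θL-▷2^-≋ : ∀ m j T {r F} → scale r F ≋ θL[ m + 2 * j ] T →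
           scale (sgn j ℚ.* r) F ≋ θL[ m ] (mapW (_▷2^ j) T)
θL-▷2^-≋ m j T {r} {F} rF≋ = begin
  scale (sgn j ℚ.* r) F                ≡⟨ scale-scale (sgn j) r F ⟨
  scale (sgn j) (scale r F)            ≈⟨ scale-cong (sgn j) rF≋ ⟩
  scale (sgn j) (θL[ m + 2 * j ] T)    ≡⟨ θL-▷2^ m j T ⟨
  θL[ m ] (mapW (_▷2^ j) T)            ∎
  where open SetoidReasoning 𝔛-setoid

θL-block-≋ : ∀ m j T {r F} → scale r F ≋ θL[ odd3 j ] T →
             scale (sgn j ℚ.* r) (xmul m F) ≋ θL[ m ] (mapW (_▷ three) (mapW (_▷2^ j) T))
θL-block-≋ m j T {r} {F} rF≋ = begin
  scale (sgn j ℚ.* r) (xmul m F)                    ≡⟨ scale-xmul (sgn j ℚ.* r) m F ⟩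
  xmul m (scale (sgn j ℚ.* r) F)                    ≈⟨ xmul-cong m (θL-▷2^-≋ 3 j T rF≋′) ⟩
  xmul m (θL[ 3 ] (mapW (_▷2^ j) T))                ≡⟨ θL-▷3 m (mapW (_▷2^ j) T) ⟨
  θL[ m ] (mapW (_▷ three) (mapW (_▷2^ j) T))       ∎
  where
  open SetoidReasoning 𝔛-setoid
  rF≋′ : scale r F ≋ θL[ 3 + 2 * j ] T
  rF≋′ = subst (λ n → scale r F ≋ θL[ n ] T) (ℕ.+-comm (2 * j) 3) rF≋

FwOddWord≋θL⋆ : ℕ → List ℕ → List ℕ → Set
FwOddWord≋θL⋆ m L₁ L₂ =
  scale (sgnΣ L₁ ℚ.* sgnΣ L₂) (fw m (oddWord L₁) (oddWord L₂)) ≋ θL[ m ] (fromBlocks L₂ ⋆ fromBlocks L₁)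

fw-oddWord-[]ʳ : ∀ m L₁ → FwOddWord≋θL⋆ m L₁ []
fw-oddWord-[]ʳ m L₁ = begin
  ((sgnΣ L₁ ℚ.* 1ℚ) ℚ.* 1ℚ , m ∷ oddWord L₁) ∷ []
    ≡⟨ cong (λ q → (q , m ∷ oddWord L₁) ∷ []) (trans (ℚ.*-identityʳ _) (ℚ.*-identityʳ _)) ⟩
  (sgnΣ L₁ , m ∷ oddWord L₁) ∷ []         ≡⟨ θ-fromBlocks m L₁ ⟨
  θ[ m ] (fromBlocks L₁)                  ≡⟨ θL-single m (fromBlocks L₁) ⟨
  θL[ m ] ((1ℚ , fromBlocks L₁) ∷ [])     ≡⟨ cong θL[ m ] (⋆-[]ˡ (fromBlocks L₁)) ⟨
  θL[ m ] ([] ⋆ fromBlocks L₁)            ∎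
  where open SetoidReasoning 𝔛-setoid

fw-oddWord-[]ˡ : ∀ m b L₂ → FwOddWord≋θL⋆ m [] (b ∷ L₂)
fw-oddWord-[]ˡ m b L₂ = begin
  ((1ℚ ℚ.* sgnΣ B) ℚ.* 1ℚ , m ∷ oddWord B) ∷ []
    ≡⟨ cong (λ q → (q , m ∷ oddWord B) ∷ []) (trans (ℚ.*-identityʳ _) (ℚ.*-identityˡ _)) ⟩
  (sgnΣ B , m ∷ oddWord B) ∷ []         ≡⟨ θ-fromBlocks m B ⟨
  θ[ m ] (fromBlocks B)                 ≡⟨ θL-single m (fromBlocks B) ⟨
  θL[ m ] ((1ℚ , fromBlocks B) ∷ [])    ∎
  where
  open SetoidReasoning 𝔛-setoid
  B = b ∷ L₂

fw-oddWord-∷ : ∀ m a L₁ b L₂ →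
  FwOddWord≋θL⋆ (odd3 a) L₁ (b ∷ L₂) → FwOddWord≋θL⋆ (odd3 b) (a ∷ L₁) L₂ →
  FwOddWord≋θL⋆ (m + odd3 a + odd3 b) L₁ L₂ → FwOddWord≋θL⋆ m (a ∷ L₁) (b ∷ L₂)
fw-oddWord-∷ m a L₁ b L₂ ih₁ ih₂ ih₃ = begin
  scale s (xmul m F₁ ++ (xmul m F₂ ++ neg F₃))
    ≡⟨ trans (scale-++ s (xmul m F₁) _) (cong (scale s (xmul m F₁) ++_) (scale-++ s (xmul m F₂) (neg F₃))) ⟩
  scale s (xmul m F₁) ++ (scale s (xmul m F₂) ++ scale s (neg F₃))
    ≈⟨ ++-cong first (++-cong second third) ⟩
  θL[ m ] G₁ ++ (θL[ m ] G₂ ++ θL[ m ] G₃)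
    -- the ⋆-recursion lists the two 3-terms in the opposite order to the f-recursion
    ≈⟨ ++-swap (θL[ m ] G₁) (θL[ m ] G₂) (θL[ m ] G₃) ⟩
  θL[ m ] G₂ ++ (θL[ m ] G₁ ++ θL[ m ] G₃)
    ≡⟨ trans (concatMap-++ _ G₂ _) (cong (θL[ m ] G₂ ++_) (concatMap-++ _ G₁ G₃)) ⟨
  θL[ m ] (fromBlocks B ⋆ fromBlocks A) ∎
  where
  open SetoidReasoning 𝔛-setoid
  open +-*-Solver
  A = a ∷ L₁
  B = b ∷ L₂
  K₁ = fromBlocks L₁
  K₂ = fromBlocks L₂
  s = sgnΣ A ℚ.* sgnΣ B
  F₁ = fw (odd3 a) (oddWord L₁) (oddWord B)
  F₂ = fw (odd3 b) (oddWord A) (oddWord L₂)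
  F₃ = fw (m + odd3 a + odd3 b) (oddWord L₁) (oddWord L₂)
  G₁ = mapW (_▷ three) (fromBlocks B ⋆ (K₁ ▷2^ a))
  G₂ = mapW (_▷ three) ((K₂ ▷2^ b) ⋆ fromBlocks A)
  G₃ = mapW (_▷2^ 3) ((K₂ ▷2^ b) ⋆ (K₁ ▷2^ a))

  first : scale s (xmul m F₁) ≋ θL[ m ] G₁
  first = begin
    scale s (xmul m F₁)
      ≡⟨ cong (λ q → scale q (xmul m F₁)) (trans (cong (ℚ._* sgnΣ B) (sgnΣ-∷ a L₁)) (ℚ.*-assoc (sgn a) (sgnΣ L₁) (sgnΣ B))) ⟩
    scale (sgn a ℚ.* (sgnΣ L₁ ℚ.* sgnΣ B)) (xmul m F₁)
      ≈⟨ θL-block-≋ m a (fromBlocks B ⋆ K₁) ih₁ ⟩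
    θL[ m ] (mapW (_▷ three) (mapW (_▷2^ a) (fromBlocks B ⋆ K₁)))
      ≡⟨ cong (λ T → θL[ m ] (mapW (_▷ three) T)) (⋆-▷2^ʳ (fromBlocks B) K₁ a) ⟨
    θL[ m ] G₁ ∎

  second : scale s (xmul m F₂) ≋ θL[ m ] G₂
  second = begin
    scale s (xmul m F₂)
      ≡⟨ cong (λ q → scale q (xmul m F₂)) (trans (cong (sgnΣ A ℚ.*_) (sgnΣ-∷ b L₂))
           (solve 3 (λ x y z → x :* (y :* z) := y :* (x :* z)) refl (sgnΣ A) (sgn b) (sgnΣ L₂))) ⟩
    scale (sgn b ℚ.* (sgnΣ A ℚ.* sgnΣ L₂)) (xmul m F₂)
      ≈⟨ θL-block-≋ m b (K₂ ⋆ fromBlocks A) ih₂ ⟩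
    θL[ m ] (mapW (_▷ three) (mapW (_▷2^ b) (K₂ ⋆ fromBlocks A)))
      ≡⟨ cong (λ T → θL[ m ] (mapW (_▷ three) T)) (⋆-▷2^ˡ K₂ (fromBlocks A) b) ⟨
    θL[ m ] G₂ ∎

  third : scale s (neg F₃) ≋ θL[ m ] G₃
  third = begin
    scale s (neg F₃)
      ≡⟨ scale-scale s (ℚ.- 1ℚ) F₃ ⟩
    scale (s ℚ.* ℚ.- 1ℚ) F₃
      ≡⟨ cong (λ q → scale q F₃) (trans (cong₂ (λ x y → x ℚ.* y ℚ.* ℚ.- 1ℚ) (sgnΣ-∷ a L₁) (sgnΣ-∷ b L₂))
           (solve 5 (λ sa x sb y z → sa :* x :* (sb :* y) :* z := z :* (sb :* (sa :* (x :* y)))) refl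
              (sgn a) (sgnΣ L₁) (sgn b) (sgnΣ L₂) (ℚ.- 1ℚ))) ⟩
    scale (sgn 3 ℚ.* (sgn b ℚ.* (sgn a ℚ.* r₃))) F₃
      ≈⟨ θL-▷2^-≋ m 3 (mapW (_▷2^ b) (mapW (_▷2^ a) (K₂ ⋆ K₁))) {r = sgn b ℚ.* (sgn a ℚ.* r₃)}
           (θL-▷2^-≋ (m + 2 * 3) b (mapW (_▷2^ a) (K₂ ⋆ K₁)) {r = sgn a ℚ.* r₃}
             (θL-▷2^-≋ (m + 2 * 3 + 2 * b) a (K₂ ⋆ K₁) ih)) ⟩
    θL[ m ] (mapW (_▷2^ 3) (mapW (_▷2^ b) (mapW (_▷2^ a) (K₂ ⋆ K₁))))
      ≡⟨ cong (λ T → θL[ m ] (mapW (_▷2^ 3) T))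
           (trans (⋆-▷2^ˡ K₂ (K₁ ▷2^ a) b) (cong (mapW (_▷2^ b)) (⋆-▷2^ʳ K₂ K₁ a))) ⟨
    θL[ m ] G₃ ∎
    where
    index : ∀ m a b → m + (2 * a + 3) + (2 * b + 3) ≡ m + 2 * 3 + 2 * b + 2 * a
    index = solve-∀
    r₃ = sgnΣ L₁ ℚ.* sgnΣ L₂
    ih : scale r₃ F₃ ≋ θL[ m + 2 * 3 + 2 * b + 2 * a ] (K₂ ⋆ K₁)
    ih = subst (λ n → scale r₃ F₃ ≋ θL[ n ] (K₂ ⋆ K₁)) (index m a b) ih₃

fw-oddWord : ∀ m L₁ L₂ → FwOddWord≋θL⋆ m L₁ L₂
fw-oddWord m L₁       []       = fw-oddWord-[]ʳ m L₁
fw-oddWord m []       (b ∷ L₂) = fw-oddWord-[]ˡ m b L₂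
fw-oddWord m (a ∷ L₁) (b ∷ L₂) = fw-oddWord-∷ m a L₁ b L₂
  (fw-oddWord (odd3 a) L₁ (b ∷ L₂)) (fw-oddWord (odd3 b) (a ∷ L₁) L₂) (fw-oddWord (m + odd3 a + odd3 b) L₁ L₂)

f-singletons : ∀ c q u r v → f c ((q , u) ∷ []) ((r , v) ∷ []) ≡ scale (q ℚ.* r) (fw c u v)
f-singletons c q u r v = trans (++-identityʳ _) (++-identityʳ _)

f-ι-ι≋θL⋆ : ∀ m k l → NotEnd2 k → NotEnd2 l → f m (ι l) (ι k) ≋ θL[ m ] (k ⋆ l)
f-ι-ι≋θL⋆ m k l k∈W′ l∈W′ = begin
  f m (ι l) (ι k)
    ≡⟨ f-singletons m (sgnΣ (blocks l)) (oddWord (blocks l)) (sgnΣ (blocks k)) (oddWord (blocks k)) ⟩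
  scale (sgnΣ (blocks l) ℚ.* sgnΣ (blocks k)) (fw m (oddWord (blocks l)) (oddWord (blocks k)))
    ≈⟨ fw-oddWord m (blocks l) (blocks k) ⟩
  θL[ m ] (fromBlocks (blocks k) ⋆ fromBlocks (blocks l))
    ≡⟨ cong₂ (λ k′ l′ → θL[ m ] (k′ ⋆ l′)) (fromBlocks-blocks k k∈W′) (fromBlocks-blocks l l∈W′) ⟩
  θL[ m ] (k ⋆ l) ∎
  where open SetoidReasoning 𝔛-setoid

lemma2p6 : (c : ℕ) (k l : W₂₃) → NotEnd2 k → NotEnd2 l →
    f (2 + 2 * c) (ι l) (ι k) ≈ scale (sgn c) (θL (mapW (_▷2^ c) (k ⋆ l)))
lemma2p6 c k l k∈W′ l∈W′ = same-coeff (begin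
  f (2 + 2 * c) (ι l) (ι k)                             ≈⟨ f-ι-ι≋θL⋆ (2 + 2 * c) k l k∈W′ l∈W′ ⟩
  θL[ 2 + 2 * c ] (k ⋆ l)                               ≡⟨ scale-sgn-involutive c _ ⟨
  scale (sgn c) (scale (sgn c) (θL[ 2 + 2 * c ] (k ⋆ l))) ≡⟨ cong (scale (sgn c)) (θL-▷2^ 2 c (k ⋆ l)) ⟨
  scale (sgn c) (θL (mapW (_▷2^ c) (k ⋆ l)))            ∎)
  where open SetoidReasoning 𝔛-setoid
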